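{- Let $p,q\ge0$, $\sigma\in S_p$, $\tau\in S_q$. If $\omega_1,\omega_2\in Sh(p,q)$ satisfy $\omega_1<\omega_2$ in the weak order, then $\omega_1\cdot(\sigma\times\tau)<\omega_2\cdot(\sigma\times\tau)$.
   Context: $S_n$: symmetric group on $\{1,\dots,n\}$, product $(\sigma\cdot\tau)(i)=\sigma(\tau(i))$, $s_i=(i\ i+1)$, $l$ the length with respect to the $s_i$. Weak order: $\omega\le\sigma$ iff $\sigma=\tau\cdot\omega$ for some $\tau$ with $l(\sigma)=l(\tau)+l(\omega)$; $<$ means $\le$ and $\ne$. $(\sigma\times\tau)(i)=\sigma(i)$ for $i\le p$, $=p+\tau(i-p)$ for $i>p$. $Sh(p,q)$: $\omega\in S_{p+q}$ with $\omega(1)<\dots<\omega(p)$ and $\omega(p+1)<\dots<\omega(p+q)$. -}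

module Defs where

open import Data.Nat using (ℕ; suc; _+_; _≤_; _<_)
open import Data.Fin as F using (Fin; toℕ; fromℕ<; _↑ˡ_; _↑ʳ_)
open import Data.Fin.Properties using (+↔⊎)
open import Data.Fin.Permutation using (Permutation′; _⟨$⟩ʳ_; _≈_; id; _∘ₚ_; transpose)
open import Data.List using (List; []; _∷_; length; foldr)
open import Data.Product using (Σ; ∃; ∃-syntax; _×_; _,_)
open import Data.Sum.Function.Propositional using (_⊎-↔_)
open import Function.Properties.Inverse using (↔-trans; ↔-sym)
open import Relation.Nullary using (¬_)
open import Relation.Binary.PropositionalEquality using (_≡_)

-- The symmetric group S_n, realised as bijections of Fin n = {0,…,n-1}
-- (index k ∈ Fin n corresponds to the point k+1 of {1,…,n}).
S : ℕ → Set
S n = Permutation′ n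

-- Paper's product: (σ · τ)(i) = σ(τ(i)).   (stdlib's π₁ ∘ₚ π₂ applies π₁ first.)
infixl 7 _·_
_·_ : ∀ {n} → S n → S n → S n
σ · τ = τ ∘ₚ σ

-- Indices of the simple transpositions s_1,…,s_{n-1}:
-- k : Fin n with k+1 < n stands for s_{k+1} = (k+1  k+2) in 1-based terms.
Adj : ℕ → Set
Adj n = Σ (Fin n) (λ k → suc (toℕ k) < n)

s : ∀ {n} → Adj n → S n
s (k , k+1<n) = transpose k (fromℕ< k+1<n)

wordProd : ∀ {n} → List (Adj n) → S n
wordProd = foldr (λ a acc → s a · acc) id

IsLength : ∀ {n} → S n → ℕ → Set
IsLength σ k =
  (Σ (List (Adj _)) λ w → (length w ≡ k) × (wordProd w ≈ σ))
  × (∀ w → wordProd w ≈ σ → k ≤ length w)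

_≤w_ : ∀ {n} → S n → S n → Set
ω ≤w σ = ∃[ τ ] ((σ ≈ τ · ω) × ∃[ a ] ∃[ b ] (IsLength τ a × IsLength ω b × IsLength σ (a + b)))

_<w_ : ∀ {n} → S n → S n → Set
ω <w σ = (ω ≤w σ) × ¬ (ω ≈ σ)

-- σ × τ ∈ S_{p+q}: acts as σ on the first p points and as p + τ(· - p) on the last q.
_⊗_ : ∀ {p q} → S p → S q → S (p + q)
σ ⊗ τ = ↔-trans +↔⊎ (↔-trans (σ ⊎-↔ τ) (↔-sym +↔⊎))

Sh : (p q : ℕ) → S (p + q) → Set
Sh p q ω =
  (∀ (i j : Fin p) → i F.< j → (ω ⟨$⟩ʳ (i ↑ˡ q)) F.< (ω ⟨$⟩ʳ (j ↑ˡ q)))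
  × (∀ (i j : Fin q) → i F.< j → (ω ⟨$⟩ʳ (p ↑ʳ i)) F.< (ω ⟨$⟩ʳ (p ↑ʳ j)))

-- The length of a permutation is its number of inversions: left multiplication by s_k
-- swaps the values k and k + 1 and so changes the inversion count by exactly one, and a
-- permutation with no left descent is the identity, so a reduced word has exactly as
-- many letters as there are inversions.  The pairs that σ × τ can invert lie inside one
-- of the blocks {1..p}, {p+1..p+q}, on which a shuffle ω is increasing; hence every
-- inversion of σ × τ is one of ω · (σ × τ), and l(ω · (σ × τ)) = l(ω) + l(σ × τ).
-- So if ω₂ = ρ · ω₁ with l(ω₂) = l(ρ) + l(ω₁), adding l(σ × τ) to both sides gives
-- l(ω₂ · (σ × τ)) = l(ρ) + l(ω₁ · (σ × τ)).
{-# OPTIONS --safe #-}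
module Submission where

open import Defs
open import Data.Nat as ℕ using (ℕ; zero; suc; _+_; _≤_; z≤n; s≤s)
open import Data.Nat.Properties
  using ( +-0-commutativeMonoid; +-identityʳ; +-assoc; +-mono-≤; +-monoʳ-≤; +-cancelʳ-≤; +-cancelˡ-<; m≤m+n
        ; ≤-antisym; ≤-reflexive; ≤-<-trans; <-≤-trans; <⇒≤; m≤n⇒m≤1+n; ≮⇒≥; suc-injective; 1+n≢0
        ; module ≤-Reasoning)
open import Data.Fin using (Fin; toℕ; fromℕ<; punchIn; _↑ˡ_; _↑ʳ_; splitAt; _<_)
open import Data.Fin.Properties
  using ( _≟_; _<?_; <-cmp; <-asym; <-irrefl; <-trans; <⇒≢; ≤∧≢⇒<; any?
        ; toℕ-injective; toℕ<n; toℕ-fromℕ<; fromℕ<-toℕ; fromℕ<-cong; toℕ-↑ˡ; toℕ-↑ʳ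
        ; splitAt-↑ˡ; splitAt-↑ʳ; splitAt⁻¹-↑ˡ; splitAt⁻¹-↑ʳ; punchInᵢ≢i)
open import Data.Fin.Permutation using (_⟨$⟩ʳ_; _⟨$⟩ˡ_; _≈_; inverseˡ; inverseʳ; flip; id)
import Data.Fin.Permutation.Components as PC
open import Data.Vec.Functional using (removeAt)
open import Data.List using (List; []; _∷_; length)
open import Data.Product using (Σ; ∃; _×_; _,_; proj₁; proj₂)
open import Data.Sum using (_⊎_; inj₁; inj₂; [_,_])
open import Function using (_∘_; _⇔_; mk⇔; Equivalence)
open import Relation.Binary using (tri<; tri≈; tri>)
open import Relation.Nullary using (Dec; yes; no; ¬_; contradiction)
open import Relation.Nullary.Decidable using (_×-dec_; dec-true; dec-false; map′)
open import Relation.Binary.PropositionalEquality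
  using (_≡_; _≢_; refl; sym; trans; cong; cong₂; subst; subst₂; module ≡-Reasoning)
open import Algebra.Properties.CommutativeMonoid.Sum +-0-commutativeMonoid
  using (sum; sum-syntax; sum-cong-≗; sum-remove; sum-permute; sum-replicate-zero; ∑-distrib-+)

private
  variable
    A B C : Set
    n : ℕ

𝟙 : Dec A → ℕ
𝟙 (yes _) = 1
𝟙 (no _)  = 0

𝟙-yes : (a? : Dec A) → A → 𝟙 a? ≡ 1
𝟙-yes (yes _) _ = refl
𝟙-yes (no ¬a) a = contradiction a ¬a

𝟙-no : (a? : Dec A) → ¬ A → 𝟙 a? ≡ 0
𝟙-no (yes a) ¬a = contradiction a ¬a
𝟙-no (no _)  _  = refl

𝟙-⊎ : A ⇔ (B ⊎ C) → ¬ (B × C) → (a? : Dec A) (b? : Dec B) (c? : Dec C) → 𝟙 a? ≡ 𝟙 b? + 𝟙 c?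
𝟙-⊎ _   disjoint (yes _) (yes b) (yes c) = contradiction (b , c) disjoint
𝟙-⊎ _   _        (yes _) (yes _) (no _)  = refl
𝟙-⊎ _   _        (yes _) (no _)  (yes _) = refl
𝟙-⊎ A⇔B⊎C _      (yes a) (no ¬b) (no ¬c) = contradiction (Equivalence.to A⇔B⊎C a) [ ¬b , ¬c ]
𝟙-⊎ A⇔B⊎C _      (no ¬a) (yes b) _       = contradiction (Equivalence.from A⇔B⊎C (inj₁ b)) ¬a
𝟙-⊎ A⇔B⊎C _      (no ¬a) (no _)  (yes c) = contradiction (Equivalence.from A⇔B⊎C (inj₂ c)) ¬a
𝟙-⊎ _   _        (no _)  (no _)  (no _)  = refl

sum-supported : (f : Fin n → ℕ) (i₀ : Fin n) → (∀ i → i ≢ i₀ → f i ≡ 0) → sum f ≡ f i₀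
sum-supported {suc n} f i₀ vanishes = begin
  sum f                       ≡⟨ sum-remove {i = i₀} f ⟩
  f i₀ + sum (removeAt f i₀)  ≡⟨ cong (f i₀ +_) (sum-cong-≗ (vanishes _ ∘ punchInᵢ≢i i₀)) ⟩
  f i₀ + sum {n} (λ _ → 0)    ≡⟨ cong (f i₀ +_) (sum-replicate-zero n) ⟩
  f i₀ + 0                    ≡⟨ +-identityʳ (f i₀) ⟩
  f i₀                        ∎
  where open ≡-Reasoning

sum-mono-≤ : {f g : Fin n → ℕ} → (∀ i → f i ≤ g i) → sum f ≤ sum g
sum-mono-≤ {zero}  _   = z≤n
sum-mono-≤ {suc n} f≤g = +-mono-≤ (f≤g Fin.zero) (sum-mono-≤ (f≤g ∘ Fin.suc))

sum-mono-≤-≡⇒≗ : {f g : Fin n → ℕ} → (∀ i → f i ≤ g i) → sum f ≡ sum g → ∀ i → f i ≡ g i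
sum-mono-≤-≡⇒≗ {suc n} {f} {g} f≤g ∑f≡∑g i = ≤-antisym (f≤g i) (+-cancelʳ-≤ _ (g i) (f i) (begin
  g i + sum (removeAt g i)  ≡⟨ sum-remove g ⟨
  sum g                     ≡⟨ ∑f≡∑g ⟨
  sum f                     ≡⟨ sum-remove f ⟩
  f i + sum (removeAt f i)  ≤⟨ +-monoʳ-≤ (f i) (sum-mono-≤ (f≤g ∘ punchIn i)) ⟩
  f i + sum (removeAt g i)  ∎))
  where open ≤-Reasoning

∑∑-distrib-+ : (F G : Fin n → Fin n → ℕ) →
  ∑[ i < n ] ∑[ j < n ] (F i j + G i j) ≡ ∑[ i < n ] ∑[ j < n ] F i j + ∑[ i < n ] ∑[ j < n ] G i j
∑∑-distrib-+ {n} F G = trans (sum-cong-≗ {n} λ i → ∑-distrib-+ (F i) (G i)) (∑-distrib-+ {n} _ _)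

∑∑-permute : (F : Fin n → Fin n → ℕ) (ρ : S n) →
  ∑[ i < n ] ∑[ j < n ] F (ρ ⟨$⟩ʳ i) (ρ ⟨$⟩ʳ j) ≡ ∑[ i < n ] ∑[ j < n ] F i j
∑∑-permute F ρ = sym (trans (sum-permute _ ρ) (sum-cong-≗ (λ i → sum-permute (F (ρ ⟨$⟩ʳ i)) ρ)))

transpose-matchˡ : (i j : Fin n) → PC.transpose i j i ≡ j
transpose-matchˡ i j rewrite dec-true (i ≟ i) refl = refl

transpose-matchʳ : (i j : Fin n) → PC.transpose i j j ≡ i
transpose-matchʳ i j with j ≟ i
... | yes j≡i = j≡i
... | no _ rewrite dec-true (j ≟ j) refl = refl

transpose-mismatch : {i j k : Fin n} → k ≢ i → k ≢ j → PC.transpose i j k ≡ k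
transpose-mismatch {i = i} {j} {k} k≢i k≢j rewrite dec-false (k ≟ i) k≢i | dec-false (k ≟ j) k≢j = refl

transpose-involutive : (i j k : Fin n) → PC.transpose i j (PC.transpose i j k) ≡ k
transpose-involutive i j k = involutive (k ≟ i) (k ≟ j)
  where
  involutive : Dec (k ≡ i) → Dec (k ≡ j) → PC.transpose i j (PC.transpose i j k) ≡ k
  involutive (yes refl) _ = trans (cong (PC.transpose k j) (transpose-matchˡ k j)) (transpose-matchʳ k j)
  involutive (no _) (yes refl) = trans (cong (PC.transpose i k) (transpose-matchʳ i k)) (transpose-matchˡ i k)
  involutive (no k≢i) (no k≢j) =
    trans (cong (PC.transpose i j) (transpose-mismatch k≢i k≢j)) (transpose-mismatch k≢i k≢j)

module _ {k k′ : Fin n} (k′≡1+k : toℕ k′ ≡ suc (toℕ k)) where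

  private
    t = PC.transpose k k′

    k<k′ : k < k′
    k<k′ = ≤-reflexive (sym k′≡1+k)

  transpose-adjacent-< : {x y : Fin n} → x < y → ¬ (x ≡ k × y ≡ k′) → t x < t y
  transpose-adjacent-< {x} {y} x<y ¬kk′ = by-cases (x ≟ k) (y ≟ k′) (x ≟ k′) (y ≟ k)
    where
    by-cases : Dec (x ≡ k) → Dec (y ≡ k′) → Dec (x ≡ k′) → Dec (y ≡ k) → t x < t y
    by-cases (yes refl) (yes refl) _ _ = contradiction (refl , refl) ¬kk′
    by-cases (yes refl) (no y≢k′) _ _
      rewrite transpose-matchˡ k k′ | transpose-mismatch (<⇒≢ x<y ∘ sym) y≢k′
      = ≤∧≢⇒< (subst (ℕ._≤ toℕ y) (sym k′≡1+k) x<y) (y≢k′ ∘ sym)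
    by-cases (no x≢k) (yes refl) _ _
      rewrite transpose-matchʳ k k′ | transpose-mismatch x≢k (<⇒≢ x<y)
      = ≤∧≢⇒< (ℕ.s≤s⁻¹ (subst (toℕ x ℕ.<_) k′≡1+k x<y)) x≢k
    by-cases (no _) (no _) (yes refl) (yes refl) = contradiction x<y (<-asym k<k′)
    by-cases (no _) (no y≢k′) (yes refl) (no y≢k)
      rewrite transpose-matchʳ k k′ | transpose-mismatch y≢k y≢k′ = <-trans k<k′ x<y
    by-cases (no x≢k) (no _) (no x≢k′) (yes refl)
      rewrite transpose-matchˡ k k′ | transpose-mismatch x≢k x≢k′ = <-trans x<y k<k′
    by-cases (no x≢k) (no y≢k′) (no x≢k′) (no y≢k)
      rewrite transpose-mismatch x≢k x≢k′ | transpose-mismatch y≢k y≢k′ = x<y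

Inversion : S n → Fin n → Fin n → Set
Inversion π i j = i < j × π ⟨$⟩ʳ j < π ⟨$⟩ʳ i

inversion? : (π : S n) (i j : Fin n) → Dec (Inversion π i j)
inversion? π i j = i <? j ×-dec π ⟨$⟩ʳ j <? π ⟨$⟩ʳ i

inversions : S n → ℕ
inversions {n} π = ∑[ i < n ] ∑[ j < n ] 𝟙 (inversion? π i j)

inversions-cong : {π ρ : S n} → π ≈ ρ → inversions π ≡ inversions ρ
inversions-cong π≈ρ = sum-cong-≗ λ i → sum-cong-≗ λ j →
  cong₂ (λ πi πj → 𝟙 (i <? j ×-dec πj <? πi)) (π≈ρ i) (π≈ρ j)

inversions-id : inversions (id {n}) ≡ 0
inversions-id {n} = trans
  (sum-cong-≗ {n} λ i → trans (sum-cong-≗ λ j → 𝟙-no (inversion? id i j) λ (i<j , j<i) → <-asym i<j j<i)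
                          (sum-replicate-zero n))
  (sum-replicate-zero n)

-- The inversions of ω · x are then those of x together with the pull-backs along x of
-- those of ω.
inversions-· : (ω x : S n) → (∀ {i j} → Inversion x i j → Inversion (ω · x) i j) →
               inversions (ω · x) ≡ inversions ω + inversions x
inversions-· {n} ω x x⊆ωx = begin
  inversions (ω · x)
    ≡⟨ sum-cong-≗ {n} (λ i → sum-cong-≗ {n} λ j →
         𝟙-⊎ split (λ ((xi<xj , _) , (_ , xj<xi)) → <-asym xi<xj xj<xi)
           (inversion? ωx i j) (inversion? ω (x ⟨$⟩ʳ i) (x ⟨$⟩ʳ j)) (inversion? x i j)) ⟩
  ∑[ i < n ] ∑[ j < n ] (𝟙 (inversion? ω (x ⟨$⟩ʳ i) (x ⟨$⟩ʳ j)) + 𝟙 (inversion? x i j))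
    ≡⟨ ∑∑-distrib-+ (λ i j → 𝟙 (inversion? ω (x ⟨$⟩ʳ i) (x ⟨$⟩ʳ j))) (λ i j → 𝟙 (inversion? x i j)) ⟩
  ∑[ i < n ] ∑[ j < n ] 𝟙 (inversion? ω (x ⟨$⟩ʳ i) (x ⟨$⟩ʳ j)) + inversions x
    ≡⟨ cong (_+ inversions x) (∑∑-permute (λ a b → 𝟙 (inversion? ω a b)) x) ⟩
  inversions ω + inversions x
    ∎
  where
  open ≡-Reasoning
  ωx = ω · x
  split : ∀ {i j} → Inversion ωx i j ⇔ (Inversion ω (x ⟨$⟩ʳ i) (x ⟨$⟩ʳ j) ⊎ Inversion x i j)
  split {i} {j} = mk⇔ to from
    where
    to : Inversion ωx i j → Inversion ω (x ⟨$⟩ʳ i) (x ⟨$⟩ʳ j) ⊎ Inversion x i j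
    to (i<j , ωxj<ωxi) with <-cmp (x ⟨$⟩ʳ i) (x ⟨$⟩ʳ j)
    ... | tri< xi<xj _ _ = inj₁ (xi<xj , ωxj<ωxi)
    ... | tri≈ _ xi≡xj _ = contradiction ωxj<ωxi (<-irrefl (cong (ω ⟨$⟩ʳ_) (sym xi≡xj)))
    ... | tri> _ _ xj<xi = inj₂ (i<j , xj<xi)
    from : Inversion ω (x ⟨$⟩ʳ i) (x ⟨$⟩ʳ j) ⊎ Inversion x i j → Inversion ωx i j
    from (inj₂ inv) = x⊆ωx inv
    from (inj₁ (xi<xj , ωxj<ωxi)) with <-cmp i j
    ... | tri< i<j _ _ = i<j , ωxj<ωxi
    ... | tri≈ _ refl _ = contradiction xi<xj (<-irrefl refl)
    ... | tri> _ _ j<i = contradiction (proj₂ (x⊆ωx (j<i , xi<xj))) (<-asym ωxj<ωxi)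

⟨$⟩ˡ-injective : (π : S n) {a b : Fin n} → π ⟨$⟩ˡ a ≡ π ⟨$⟩ˡ b → a ≡ b
⟨$⟩ˡ-injective π {a} {b} eq = begin
  a                    ≡⟨ inverseʳ π ⟨
  π ⟨$⟩ʳ (π ⟨$⟩ˡ a)    ≡⟨ cong (π ⟨$⟩ʳ_) eq ⟩
  π ⟨$⟩ʳ (π ⟨$⟩ˡ b)    ≡⟨ inverseʳ π ⟩
  b                    ∎
  where open ≡-Reasoning

·-cancelʳ : (ω₁ ω₂ x : S n) → ω₁ · x ≈ ω₂ · x → ω₁ ≈ ω₂
·-cancelʳ ω₁ ω₂ x ω₁x≈ω₂x i = subst (λ j → ω₁ ⟨$⟩ʳ j ≡ ω₂ ⟨$⟩ʳ j) (inverseʳ x) (ω₁x≈ω₂x (x ⟨$⟩ˡ i))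

module _ (k : Fin n) (k+1<n : suc (toℕ k) ℕ.< n) where

  private
    k′ = fromℕ< k+1<n
    k′≡1+k = toℕ-fromℕ< k+1<n
    sₖ = s (k , k+1<n)

    k<k′ : k < k′
    k<k′ = ≤-reflexive (sym k′≡1+k)

  inversions-s : inversions sₖ ≡ 1
  inversions-s = begin
    inversions sₖ                  ≡⟨ sum-supported _ k (λ i i≢k →
                                        trans (sum-supported _ k′ λ _ _ → not-inversion (i≢k ∘ proj₁))
                                              (not-inversion (i≢k ∘ proj₁))) ⟩
    ∑[ j < n ] 𝟙 (inversion? sₖ k j) ≡⟨ sum-supported _ k′ (λ j j≢k′ → not-inversion (j≢k′ ∘ proj₂)) ⟩
    𝟙 (inversion? sₖ k k′)          ≡⟨ 𝟙-yes (inversion? sₖ k k′) (k<k′ , sₖk′<sₖk) ⟩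
    1                               ∎
    where
    open ≡-Reasoning
    not-inversion : ∀ {i j} → ¬ (i ≡ k × j ≡ k′) → 𝟙 (inversion? sₖ i j) ≡ 0
    not-inversion ¬kk′ = 𝟙-no _ λ (i<j , sⱼ<sᵢ) → <-asym sⱼ<sᵢ (transpose-adjacent-< k′≡1+k i<j ¬kk′)
    sₖk′<sₖk : sₖ ⟨$⟩ʳ k′ < sₖ ⟨$⟩ʳ k
    sₖk′<sₖk = subst₂ _<_ (sym (transpose-matchʳ k k′)) (sym (transpose-matchˡ k k′)) k<k′

  inversions-s·-ascent : (π : S n) → π ⟨$⟩ˡ k < π ⟨$⟩ˡ k′ → inversions (sₖ · π) ≡ suc (inversions π)
  inversions-s·-ascent π π⁻¹k<π⁻¹k′ =
    trans (inversions-· sₖ π preserved) (cong (_+ inversions π) inversions-s)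
    where
    position : ∀ {i y} → π ⟨$⟩ʳ i ≡ y → π ⟨$⟩ˡ y ≡ i
    position {i} πi≡y = trans (cong (π ⟨$⟩ˡ_) (sym πi≡y)) (inverseˡ π)
    preserved : ∀ {i j} → Inversion π i j → Inversion (sₖ · π) i j
    preserved (i<j , πj<πi) = i<j , transpose-adjacent-< k′≡1+k πj<πi λ (πj≡k , πi≡k′) →
      <-asym i<j (subst₂ _<_ (position πj≡k) (position πi≡k′) π⁻¹k<π⁻¹k′)

  inversions-s·-descent : (π : S n) → π ⟨$⟩ˡ k′ < π ⟨$⟩ˡ k → suc (inversions (sₖ · π)) ≡ inversions π
  inversions-s·-descent π π⁻¹k′<π⁻¹k = begin
    suc (inversions (sₖ · π))   ≡⟨ inversions-s·-ascent (sₖ · π) ascent ⟨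
    inversions (sₖ · (sₖ · π))  ≡⟨ inversions-cong {π = sₖ · (sₖ · π)} {π} sₖsₖπ≈π ⟩
    inversions π                ∎
    where
    open ≡-Reasoning
    sₖsₖπ≈π : sₖ · (sₖ · π) ≈ π
    sₖsₖπ≈π = transpose-involutive k k′ ∘ (π ⟨$⟩ʳ_)
    ascent : (sₖ · π) ⟨$⟩ˡ k < (sₖ · π) ⟨$⟩ˡ k′
    ascent = subst₂ _<_ (cong (π ⟨$⟩ˡ_) (sym (transpose-matchʳ k′ k)))
                        (cong (π ⟨$⟩ˡ_) (sym (transpose-matchˡ k′ k))) π⁻¹k′<π⁻¹k

  inversions-s·-≤ : (π : S n) → inversions (sₖ · π) ≤ suc (inversions π)
  inversions-s·-≤ π with <-cmp (π ⟨$⟩ˡ k) (π ⟨$⟩ˡ k′)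
  ... | tri< π⁻¹k<π⁻¹k′ _ _ = ≤-reflexive (inversions-s·-ascent π π⁻¹k<π⁻¹k′)
  ... | tri≈ _ π⁻¹k≡π⁻¹k′ _ = contradiction (⟨$⟩ˡ-injective π π⁻¹k≡π⁻¹k′) (<⇒≢ k<k′)
  ... | tri> _ _ π⁻¹k′<π⁻¹k = m≤n⇒m≤1+n (<⇒≤ (≤-reflexive (inversions-s·-descent π π⁻¹k′<π⁻¹k)))

inversions-≤-length : {π : S n} (w : List (Adj n)) → wordProd w ≈ π → inversions π ≤ length w
inversions-≤-length {n} {π} [] id≈π =
  ≤-reflexive (trans (inversions-cong {π = π} {id} (sym ∘ id≈π)) (inversions-id {n}))
inversions-≤-length {π = π} ((k , k+1<n) ∷ w) w≈π = begin
  inversions π                             ≡⟨ inversions-cong {π = π} {sₖ · wordProd w} (sym ∘ w≈π) ⟩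
  inversions (sₖ · wordProd w)             ≤⟨ inversions-s·-≤ k k+1<n (wordProd w) ⟩
  suc (inversions (wordProd w))            ≤⟨ s≤s (inversions-≤-length {π = wordProd w} w (λ _ → refl)) ⟩
  suc (length w)                           ∎
  where
  open ≤-Reasoning
  sₖ = s (k , k+1<n)

-- ρ moves no point down, while ∑ toℕ is invariant under ρ.
ascending⇒id : (ρ : S n) → (∀ k (k+1<n : suc (toℕ k) ℕ.< n) → ρ ⟨$⟩ʳ k < ρ ⟨$⟩ʳ fromℕ< k+1<n) →
               ∀ i → ρ ⟨$⟩ʳ i ≡ i
ascending⇒id {n} ρ ascending i =
  toℕ-injective (sym (sum-mono-≤-≡⇒≗ {f = toℕ} ≤ρ (sum-permute toℕ ρ) i))
  where
  ≤ρ-fromℕ< : ∀ m (m<n : m ℕ.< n) → m ≤ toℕ (ρ ⟨$⟩ʳ fromℕ< m<n)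
  ≤ρ-fromℕ< zero    _       = z≤n
  ≤ρ-fromℕ< (suc m) 1+m<n = ≤-<-trans (≤ρ-fromℕ< m m<n)
    (subst (λ j → ρ ⟨$⟩ʳ fromℕ< m<n < ρ ⟨$⟩ʳ j)
           (fromℕ<-cong _ _ (cong suc (toℕ-fromℕ< m<n)) _ 1+m<n)
           (ascending (fromℕ< m<n) (subst (λ j → suc j ℕ.< n) (sym (toℕ-fromℕ< m<n)) 1+m<n)))
    where m<n = <⇒≤ 1+m<n
  ≤ρ : ∀ i → toℕ i ≤ toℕ (ρ ⟨$⟩ʳ i)
  ≤ρ i = subst (λ j → toℕ i ≤ toℕ (ρ ⟨$⟩ʳ j)) (fromℕ<-toℕ i (toℕ<n i)) (≤ρ-fromℕ< (toℕ i) (toℕ<n i))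

Descent : S n → Fin n → Set
Descent {n} π k = Σ (suc (toℕ k) ℕ.< n) λ k+1<n → π ⟨$⟩ˡ fromℕ< k+1<n < π ⟨$⟩ˡ k

descent? : (π : S n) (k : Fin n) → Dec (Descent π k)
descent? {n} π k with suc (toℕ k) ℕ.<? n
... | no  k+1≮n = no (k+1≮n ∘ proj₁)
... | yes k+1<n = map′ (k+1<n ,_) proj₂ (π ⟨$⟩ˡ fromℕ< k+1<n <? π ⟨$⟩ˡ k)

no-descent⇒id : (π : S n) → ¬ ∃ (Descent π) → ∀ i → π ⟨$⟩ʳ i ≡ i
no-descent⇒id π no-descent i =
  trans (cong (π ⟨$⟩ʳ_) (sym (ascending⇒id (flip π) ascending i))) (inverseʳ π)
  where
  ascending : ∀ k (k+1<n : suc (toℕ k) ℕ.< _) → π ⟨$⟩ˡ k < π ⟨$⟩ˡ fromℕ< k+1<n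
  ascending k k+1<n = ≤∧≢⇒< (≮⇒≥ λ k′<k → no-descent (k , k+1<n , k′<k))
    λ π⁻¹k≡π⁻¹k′ → <⇒≢ (≤-reflexive (sym (toℕ-fromℕ< k+1<n))) (⟨$⟩ˡ-injective π π⁻¹k≡π⁻¹k′)

reducedWord : ∀ m (π : S n) → inversions π ≡ m → Σ (List (Adj n)) λ w → length w ≡ m × wordProd w ≈ π
reducedWord m π inv≡m with any? (descent? π)
reducedWord zero π inv≡0 | yes (k , k+1<n , descent) =
  contradiction (trans (inversions-s·-descent k k+1<n π descent) inv≡0) 1+n≢0
reducedWord (suc m) π inv≡1+m | yes (k , k+1<n , descent)
  with reducedWord m (s (k , k+1<n) · π)
         (suc-injective (trans (inversions-s·-descent k k+1<n π descent) inv≡1+m))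
... | w , length≡m , w≈sπ =
  (k , k+1<n) ∷ w , cong suc length≡m ,
  λ i → trans (cong (PC.transpose k (fromℕ< k+1<n)) (w≈sπ i)) (transpose-involutive _ _ (π ⟨$⟩ʳ i))
reducedWord {n} m π inv≡m | no no-descent =
  [] , trans (sym (trans (inversions-cong {π = π} {id} π≈id) (inversions-id {n}))) inv≡m , sym ∘ π≈id
  where π≈id = no-descent⇒id π no-descent

inversions-isLength : (π : S n) → IsLength π (inversions π)
inversions-isLength π = reducedWord _ π refl , λ w → inversions-≤-length {π = π} w

isLength⇒≡inversions : {π : S n} {m : ℕ} → IsLength π m → m ≡ inversions π
isLength⇒≡inversions {π = π} ((w , length≡m , w≈π) , minimal) with reducedWord _ π refl
... | w′ , length≡inv , w′≈π = ≤-antisym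
  (subst (_ ≤_) length≡inv (minimal w′ w′≈π))
  (subst (_ ≤_) length≡m (inversions-≤-length {π = π} w w≈π))

data Block (p q : ℕ) : Fin (p + q) → Set where
  left  : (a : Fin p) → Block p q (a ↑ˡ q)
  right : (b : Fin q) → Block p q (p ↑ʳ b)

block : ∀ p q (i : Fin (p + q)) → Block p q i
block p q i with splitAt p i in splitAt≡
... | inj₁ a = subst (Block p q) (splitAt⁻¹-↑ˡ splitAt≡) (left a)
... | inj₂ b = subst (Block p q) (splitAt⁻¹-↑ʳ splitAt≡) (right b)

module _ {p q : ℕ} where

  ↑ˡ-<-↑ʳ : (a : Fin p) (b : Fin q) → a ↑ˡ q < p ↑ʳ b
  ↑ˡ-<-↑ʳ a b rewrite toℕ-↑ˡ a q | toℕ-↑ʳ p b = <-≤-trans (toℕ<n a) (m≤m+n p (toℕ b))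

  ↑ˡ-<⁻¹ : {a a′ : Fin p} → a ↑ˡ q < a′ ↑ˡ q → a < a′
  ↑ˡ-<⁻¹ {a} {a′} lt rewrite toℕ-↑ˡ a q | toℕ-↑ˡ a′ q = lt

  ↑ʳ-<⁻¹ : {b b′ : Fin q} → p ↑ʳ b < p ↑ʳ b′ → b < b′
  ↑ʳ-<⁻¹ {b} {b′} lt rewrite toℕ-↑ʳ p b | toℕ-↑ʳ p b′ = +-cancelˡ-< p _ _ lt

  module _ (σ : S p) (τ : S q) where

    ⊗-↑ˡ : (a : Fin p) → (σ ⊗ τ) ⟨$⟩ʳ (a ↑ˡ q) ≡ (σ ⟨$⟩ʳ a) ↑ˡ q
    ⊗-↑ˡ a rewrite splitAt-↑ˡ p a q = refl

    ⊗-↑ʳ : (b : Fin q) → (σ ⊗ τ) ⟨$⟩ʳ (p ↑ʳ b) ≡ p ↑ʳ (τ ⟨$⟩ʳ b)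
    ⊗-↑ʳ b rewrite splitAt-↑ʳ p q b = refl

    -- σ ⊗ τ inverts only pairs inside one block, where a shuffle is increasing.
    shuffle-preserves-⊗-inversions : (ω : S (p + q)) → Sh p q ω →
      ∀ {i j} → Inversion (σ ⊗ τ) i j → Inversion (ω · (σ ⊗ τ)) i j
    shuffle-preserves-⊗-inversions ω (ω↑ˡ , ω↑ʳ) {i} {j} (i<j , xj<xi) with block p q i | block p q j
    ... | left a  | left a′  rewrite ⊗-↑ˡ a | ⊗-↑ˡ a′ = i<j , ω↑ˡ _ _ (↑ˡ-<⁻¹ xj<xi)
    ... | left a  | right b  rewrite ⊗-↑ˡ a | ⊗-↑ʳ b  = contradiction xj<xi (<-asym (↑ˡ-<-↑ʳ _ _))
    ... | right b | left a   = contradiction i<j (<-asym (↑ˡ-<-↑ʳ a b))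
    ... | right b | right b′ rewrite ⊗-↑ʳ b | ⊗-↑ʳ b′ = i<j , ω↑ʳ _ _ (↑ʳ-<⁻¹ xj<xi)

    inversions-shuffle·⊗ : (ω : S (p + q)) → Sh p q ω →
      inversions (ω · (σ ⊗ τ)) ≡ inversions ω + inversions (σ ⊗ τ)
    inversions-shuffle·⊗ ω sh = inversions-· ω (σ ⊗ τ) (shuffle-preserves-⊗-inversions ω sh)

lemma1p5 : (p q : ℕ) (σ : S p) (τ : S q) (ω₁ ω₂ : S (p + q)) →
    Sh p q ω₁ → Sh p q ω₂ → ω₁ <w ω₂ →
    (ω₁ · (σ ⊗ τ)) <w (ω₂ · (σ ⊗ τ))
lemma1p5 p q σ τ ω₁ ω₂ sh₁ sh₂ ((ρ , ω₂≈ρω₁ , a , b , len-ρ , len-ω₁ , len-ω₂) , ω₁≉ω₂) =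
  (ρ , ω₂≈ρω₁ ∘ (x ⟨$⟩ʳ_) , a , inversions (ω₁ · x) , len-ρ , inversions-isLength (ω₁ · x) ,
   subst (IsLength (ω₂ · x)) lengths-add (inversions-isLength (ω₂ · x))) ,
  ω₁≉ω₂ ∘ ·-cancelʳ ω₁ ω₂ x
  where
  x = σ ⊗ τ
  lengths-add : inversions (ω₂ · x) ≡ a + inversions (ω₁ · x)
  lengths-add = begin
    inversions (ω₂ · x)                 ≡⟨ inversions-shuffle·⊗ σ τ ω₂ sh₂ ⟩
    inversions ω₂ + inversions x        ≡⟨ cong (_+ inversions x) (isLength⇒≡inversions {π = ω₂} len-ω₂) ⟨
    a + b + inversions x                ≡⟨ cong (λ l → a + l + inversions x) (isLength⇒≡inversions {π = ω₁} len-ω₁) ⟩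
    a + inversions ω₁ + inversions x    ≡⟨ +-assoc a _ _ ⟩
    a + (inversions ω₁ + inversions x)  ≡⟨ cong (a +_) (inversions-shuffle·⊗ σ τ ω₁ sh₁) ⟨
    a + inversions (ω₁ · x)             ∎
    where open ≡-Reasoning
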